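{- A closed subset $H\subseteq S_\infty$ is a subgroup if and only if $\mathcal F(H)$ is a sharp back-and-forth system on $\mathcal E=(\omega,=)$.
   Context: $S_\infty=\mathrm{Aut}(\omega,=)$ is the group of permutations of $\omega$ with the pointwise convergence topology. $I=\bigcup_n(\omega^n\times\omega^n)$; for closed $C\subseteq S_\infty$, $\mathcal F(C)=\{(\bar a,\bar b)\in I:\exists\sigma\in C\ \sigma(\bar a)=\bar b\}$. A back-and-forth system on $(\omega,=)$ is a nonempty $\mathcal F\subseteq I$ such that for $(\bar a,\bar b)\in\mathcal F$, $a_i=a_j\iff b_i=b_j$, and for every $c$ there is $d$ with $(\bar ac,\bar bd)\in\mathcal F$ and for every $d$ there is $c$ with $(\bar ac,\bar bd)\in\mathcal F$. It is sharp if it is closed under $(\bar a,\bar b)\mapsto((a_{f(0)},\dots,a_{f(k-1)}),(b_{f(0)},\dots,b_{f(k-1)}))$ for all injections $f:k\to n$, and for each $k$, $\mathcal F\cap\omega^{2k}$ is an equivalence relation on $\omega^k$. -}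

module Defs where

open import Data.Nat using (ℕ)
open import Data.Fin using (Fin; toℕ)
open import Data.Vec using (Vec; lookup; tabulate; _∷ʳ_)
open import Data.Product using (Σ; ∃; ∃-syntax; _×_; _,_)
open import Function using (_↔_; Inverse; _⇔_)
open import Function.Definitions using (Injective)
open import Function.Construct.Identity using (↔-id)
open import Function.Construct.Symmetry using (↔-sym)
open import Function.Construct.Composition using (_↔-∘_)
open import Relation.Binary.Structures using (IsEquivalence)
open import Relation.Binary.PropositionalEquality using (_≡_)

Perm : Set
Perm = ℕ ↔ ℕ

app : Perm → ℕ → ℕ
app σ = Inverse.to σ

PermSet : Set₁
PermSet = Perm → Set

AgreeBelow : ℕ → Perm → Perm → Set
AgreeBelow n σ τ = (i : Fin n) → app σ (toℕ i) ≡ app τ (toℕ i)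

-- C is closed in the pointwise-convergence topology: C contains every
-- point of its closure (every basic neighbourhood of σ meets C ⇒ σ ∈ C).
Closed : PermSet → Set
Closed C = (σ : Perm) → ((n : ℕ) → ∃[ τ ] (C τ × AgreeBelow n σ τ)) → C σ

IsSubgroup : PermSet → Set
IsSubgroup H =
  H (↔-id ℕ)
  × ((σ τ : Perm) → H σ → H τ → H (σ ↔-∘ τ))
  × ((σ : Perm) → H σ → H (↔-sym σ))

PairSet : Set₁
PairSet = ∀ {n} → Vec ℕ n → Vec ℕ n → Set

Maps : ∀ {n} → Perm → Vec ℕ n → Vec ℕ n → Set
Maps σ a b = ∀ i → app σ (lookup a i) ≡ lookup b i

𝓕 : PermSet → PairSet
𝓕 C a b = ∃[ σ ] (C σ × Maps σ a b)

IsBackAndForth : PairSet → Set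
IsBackAndForth F =
  (∃[ n ] Σ (Vec ℕ n) λ a → Σ (Vec ℕ n) λ b → F a b)
  × (∀ {n} (a b : Vec ℕ n) → F a b →
       ((i j : Fin n) → (lookup a i ≡ lookup a j) ⇔ (lookup b i ≡ lookup b j))
       × ((c : ℕ) → ∃[ d ] F (a ∷ʳ c) (b ∷ʳ d))
       × ((d : ℕ) → ∃[ c ] F (a ∷ʳ c) (b ∷ʳ d)))

IsSharp : PairSet → Set
IsSharp F =
  (∀ {k n} (f : Fin k → Fin n) → Injective _≡_ _≡_ f →
     (a b : Vec ℕ n) → F a b →
     F (tabulate (λ i → lookup a (f i))) (tabulate (λ i → lookup b (f i))))
  × (∀ k → IsEquivalence (F {k}))

IsSharpBackAndForth : PairSet → Set
IsSharpBackAndForth F = IsBackAndForth F × IsSharp F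

module Submission where

open import Defs
open import Data.Nat using (ℕ)
open import Data.Fin using (Fin; toℕ; zero; suc)
open import Data.Vec using (Vec; []; _∷_; lookup; tabulate; _∷ʳ_)
open import Data.Vec.Properties using (lookup∘tabulate)
open import Data.Product using (∃-syntax; _×_; _,_)
open import Function using (Inverse; _⇔_; mk⇔; _∘_)
open import Function.Construct.Identity using (↔-id)
open import Function.Construct.Symmetry using (↔-sym)
open import Function.Construct.Composition using (_↔-∘_)
open import Relation.Binary.Structures using (IsEquivalence)
open import Relation.Binary.PropositionalEquality using (_≡_; refl; sym; trans; cong; module ≡-Reasoning)

-- If H is a subgroup, the identity, composition and inversion in H make each
-- level of 𝓕(H) reflexive, transitive and symmetric, while extending σ(ā) = b̄ by
-- σ(c) or σ⁻¹(d) gives the back-and-forth property. Conversely, a closed H contains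
-- every σ whose initial segments (0…n-1 ↦ σ(0)…σ(n-1)) all lie in 𝓕(H); for
-- σ = id, στ and σ⁻¹ with σ, τ ∈ H these segments are obtained from segments
-- of σ and τ by reflexivity, transitivity and symmetry of 𝓕(H).

from : Perm → ℕ → ℕ
from = Inverse.from

app-from : (σ : Perm) (x : ℕ) → app σ (from σ x) ≡ x
app-from = Inverse.strictlyInverseˡ

from-app : (σ : Perm) (x : ℕ) → from σ (app σ x) ≡ x
from-app = Inverse.strictlyInverseʳ

module _ {n : ℕ} where

  Maps-id : (a : Vec ℕ n) → Maps (↔-id ℕ) a a
  Maps-id a i = refl

  Maps-∘ : ∀ σ τ (a b c : Vec ℕ n) → Maps σ b c → Maps τ a b → Maps (σ ↔-∘ τ) a c
  Maps-∘ σ τ a b c bc ab i = trans (cong (app σ) (ab i)) (bc i)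

  Maps-sym : ∀ σ (a b : Vec ℕ n) → Maps σ a b → Maps (↔-sym σ) b a
  Maps-sym σ a b ab i = begin
    from σ (lookup b i)           ≡⟨ cong (from σ) (ab i) ⟨
    from σ (app σ (lookup a i))   ≡⟨ from-app σ (lookup a i) ⟩
    lookup a i                    ∎
    where open ≡-Reasoning

  Maps-respects-≡ : ∀ σ (a b : Vec ℕ n) → Maps σ a b →
                    (i j : Fin n) → (lookup a i ≡ lookup a j) ⇔ (lookup b i ≡ lookup b j)
  Maps-respects-≡ σ a b ab i j = mk⇔ forth back
    where
    forth : lookup a i ≡ lookup a j → lookup b i ≡ lookup b j
    forth e = trans (sym (ab i)) (trans (cong (app σ) e) (ab j))

    back : lookup b i ≡ lookup b j → lookup a i ≡ lookup a j
    back e = trans (sym (Maps-sym σ a b ab i)) (trans (cong (from σ) e) (Maps-sym σ a b ab j))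

Maps-∷ʳ : ∀ {n} σ (a b : Vec ℕ n) {c d : ℕ} →
          Maps σ a b → app σ c ≡ d → Maps σ (a ∷ʳ c) (b ∷ʳ d)
Maps-∷ʳ σ []      []      ab cd zero    = cd
Maps-∷ʳ σ (_ ∷ _) (_ ∷ _) ab cd zero    = ab zero
Maps-∷ʳ σ (_ ∷ a) (_ ∷ b) ab cd (suc i) = Maps-∷ʳ σ a b (ab ∘ suc) cd i

Maps-tabulate : ∀ {n} (σ : Perm) (f : Fin n → ℕ) →
                Maps σ (tabulate f) (tabulate (app σ ∘ f))
Maps-tabulate σ f i = trans (cong (app σ) (lookup∘tabulate f i))
                            (sym (lookup∘tabulate (app σ ∘ f) i))

Maps-restrict : ∀ {k n} σ (f : Fin k → Fin n) (a b : Vec ℕ n) → Maps σ a b →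
                Maps σ (tabulate (lookup a ∘ f)) (tabulate (lookup b ∘ f))
Maps-restrict σ f a b ab i =
  trans (cong (app σ) (lookup∘tabulate (lookup a ∘ f) i))
        (trans (ab (f i)) (sym (lookup∘tabulate (lookup b ∘ f) i)))

module _ (C : PermSet) where

  𝓕-restrict : ∀ {k n} (f : Fin k → Fin n) (a b : Vec ℕ n) → 𝓕 C a b →
               𝓕 C (tabulate (lookup a ∘ f)) (tabulate (lookup b ∘ f))
  𝓕-restrict f a b (σ , σ∈C , ab) = σ , σ∈C , Maps-restrict σ f a b ab

  𝓕-isBackAndForth : (σ : Perm) → C σ → IsBackAndForth (𝓕 C)
  𝓕-isBackAndForth σ σ∈C = (0 , [] , [] , σ , σ∈C , λ ()) , λ a b (τ , τ∈C , ab) →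
      Maps-respects-≡ τ a b ab
    , (λ c → app τ c , τ , τ∈C , Maps-∷ʳ τ a b ab refl)
    , (λ d → from τ d , τ , τ∈C , Maps-∷ʳ τ a b ab (app-from τ d))

  𝓕-isEquivalence : IsSubgroup C → ∀ k → IsEquivalence (𝓕 C {k})
  𝓕-isEquivalence (id∈C , ∘∈C , sym∈C) k = record
    { refl  = λ {a} → ↔-id ℕ , id∈C , Maps-id a
    ; sym   = λ { {a} {b} (σ , σ∈C , ab) → ↔-sym σ , sym∈C σ σ∈C , Maps-sym σ a b ab }
    ; trans = λ { {a} {b} {c} (σ , σ∈C , ab) (τ , τ∈C , bc) →
                  τ ↔-∘ σ , ∘∈C τ σ τ∈C σ∈C , Maps-∘ τ σ a b c bc ab }
    }

indices : (n : ℕ) → Vec ℕ n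
indices n = tabulate toℕ

segment : (n : ℕ) → Perm → Vec ℕ n
segment n σ = tabulate (app σ ∘ toℕ)

Maps-segment : ∀ n σ → Maps σ (indices n) (segment n σ)
Maps-segment n σ = Maps-tabulate σ toℕ

Maps-segment⇒AgreeBelow : ∀ n σ τ → Maps τ (indices n) (segment n σ) → AgreeBelow n σ τ
Maps-segment⇒AgreeBelow n σ τ m i =
  trans (sym (lookup∘tabulate (app σ ∘ toℕ) i))
        (trans (sym (m i)) (cong (app τ) (lookup∘tabulate toℕ i)))

closed⇒segments∈𝓕⇒∈ : {C : PermSet} → Closed C → (σ : Perm) →
                          (∀ n → 𝓕 C (indices n) (segment n σ)) → C σ
closed⇒segments∈𝓕⇒∈ {C} closed σ seg = closed σ near
  where
  near : ∀ n → ∃[ τ ] (C τ × AgreeBelow n σ τ)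
  near n with seg n
  ... | τ , τ∈C , m = τ , τ∈C , Maps-segment⇒AgreeBelow n σ τ m

closed-𝓕-isEquivalence⇒isSubgroup : (H : PermSet) → Closed H →
  (∀ k → IsEquivalence (𝓕 H {k})) → IsSubgroup H
closed-𝓕-isEquivalence⇒isSubgroup H closed eqv = id∈H , ∘∈H , sym∈H
  where
  module E (k : ℕ) = IsEquivalence (eqv k)

  id∈H : H (↔-id ℕ)
  id∈H = closed⇒segments∈𝓕⇒∈ closed (↔-id ℕ) (λ n → E.refl n {indices n})

  ∘∈H : (σ τ : Perm) → H σ → H τ → H (σ ↔-∘ τ)
  ∘∈H σ τ σ∈H τ∈H = closed⇒segments∈𝓕⇒∈ closed (σ ↔-∘ τ) λ n →
    E.trans n {indices n} {segment n τ} {segment n (σ ↔-∘ τ)}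
      (τ , τ∈H , Maps-segment n τ) (σ , σ∈H , Maps-tabulate σ (app τ ∘ toℕ))

  sym∈H : (σ : Perm) → H σ → H (↔-sym σ)
  sym∈H σ σ∈H = closed⇒segments∈𝓕⇒∈ closed (↔-sym σ) λ n →
    E.sym n {segment n (↔-sym σ)} {indices n}
      (σ , σ∈H , Maps-sym (↔-sym σ) (indices n) (segment n (↔-sym σ))
                          (Maps-segment n (↔-sym σ)))

lemma4p3 : (H : PermSet) → Closed H →
    IsSubgroup H ⇔ IsSharpBackAndForth (𝓕 H)
lemma4p3 H closed = mk⇔ forth back
  where
  forth : IsSubgroup H → IsSharpBackAndForth (𝓕 H)
  -- Restriction along f preserves 𝓕(H) whether or not f is injective.
  forth sg@(id∈H , _) =
    𝓕-isBackAndForth H (↔-id ℕ) id∈H , (λ f _ → 𝓕-restrict H f) , 𝓕-isEquivalence H sg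

  back : IsSharpBackAndForth (𝓕 H) → IsSubgroup H
  back (_ , _ , eqv) = closed-𝓕-isEquivalence⇒isSubgroup H closed eqv
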